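{- Let $r\ge4$ be an integer. Then $H_s\cup H_r$ is a circuit-hyperplane of the Kinser matroid $\mathrm{Kin}(r)$ for every $s\in\{1,\dots,r-1\}$.
   Context: Kinser matroids. Let $r\ge4$ be an integer. Let $H_1,\dots,H_r$ be pairwise disjoint sets with $|H_1|=\cdots=|H_{r-1}|=r-2$ and $H_r=\{e,f\}$, and let $E=H_1\cup\cdots\cup H_r$. Let $\mathcal{A}=E$, $\mathcal{A}'=H_r$, and for $i\in\{1,\dots,r-1\}$ let $\mathcal{A}_i=(H_1\cup\cdots\cup H_{r-1})-(H_{i-1}\cup H_i)$, where subscripts are interpreted modulo $r-1$ (so $H_0=H_{r-1}$). Let $M_{r+1}$ be the transversal matroid $M[\mathcal{A}_1,\dots,\mathcal{A}_{r-1},\mathcal{A},\mathcal{A}']$ on $E$ (its independent sets are the partial transversals of this family of $r+1$ sets); it has rank $r+1$. The Kinser matroid $\mathrm{Kin}(r)$ is the truncation of $M_{r+1}$, i.e. the matroid on $E$ whose independent sets are the independent sets of $M_{r+1}$ of size at most $r$. A circuit-hyperplane is a set that is both a circuit and a hyperplane. -}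

module Defs where

open import Level using (0ℓ)
open import Data.Nat using (ℕ; suc; _∸_; _+_)
open import Data.Fin using (Fin; toℕ)
open import Data.Product using (Σ; Σ-syntax; ∃; ∃-syntax; _×_; proj₁)
open import Data.Sum using (_⊎_)
open import Data.Unit using (⊤)
open import Data.Empty using (⊥)
open import Relation.Nullary using (¬_)
open import Relation.Binary.PropositionalEquality using (_≡_)
open import Relation.Unary using (Pred; _⊆_; _∈_; _∉_; _∪_; ｛_｝)

-- Ground set E = H_1 ∪ ... ∪ H_{r-1} ∪ H_r  of Kin(r).
-- blk j k  is the k-th element of H_{j+1}  (j : Fin (r-1), k : Fin (r-2)),
-- so the blocks H_1,...,H_{r-1} are indexed 0-based by  Fin (r ∸ 1):
-- the block with index j is H_{toℕ j + 1}.
-- H_r = {e , f}.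

data Elt (r : ℕ) : Set where
  blk : Fin (r ∸ 1) → Fin (r ∸ 2) → Elt r
  e   : Elt r
  f   : Elt r

ESet : ℕ → Set₁
ESet r = Pred (Elt r) 0ℓ

H : (r : ℕ) → Fin (r ∸ 1) → ESet r
H r j (blk j' _) = j' ≡ j
H r j e = ⊥
H r j f = ⊥

Hr : (r : ℕ) → ESet r
Hr r (blk _ _) = ⊥
Hr r e = ⊤
Hr r f = ⊤

-- The set system  (A_1, ..., A_{r-1}, A, A').
-- For k : Fin (r ∸ 1), the index  setA k  stands for A_{toℕ k + 1}.

data Idx (r : ℕ) : Set where
  setA  : Fin (r ∸ 1) → Idx r
  whole : Idx r
  prime : Idx r

-- Block j (i.e. H_{j+1}) is removed from A_{k+1}
-- iff  H_{j+1} ∈ {H_k , H_{k+1}}  with subscripts mod r-1 (H_0 = H_{r-1}),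
-- i.e. (0-based) j = k, or j + 1 = k, or (k = 0 and j = r-2).
Excluded : (r : ℕ) → Fin (r ∸ 1) → Fin (r ∸ 1) → Set
Excluded r k j =
  (toℕ j ≡ toℕ k) ⊎ (suc (toℕ j) ≡ toℕ k) ⊎ ((toℕ k ≡ 0) × (suc (toℕ j) ≡ r ∸ 1))

Mem : (r : ℕ) → Idx r → ESet r
Mem r (setA k) (blk j _) = ¬ Excluded r k j
Mem r (setA k) e = ⊥
Mem r (setA k) f = ⊥
Mem r whole x = ⊤
Mem r prime x = Hr r x

-- X is a partial transversal of (A_1,...,A_{r-1},A,A'):
-- an injective assignment of each element of X to a set of the family
-- containing it.
IndepM : (r : ℕ) → ESet r → Set
IndepM r X =
  Σ[ φ ∈ (Σ (Elt r) X → Idx r) ]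
    ((∀ p q → φ p ≡ φ q → proj₁ p ≡ proj₁ q)
     × (∀ p → Mem r (φ p) (proj₁ p)))

SizeAtMost : (r : ℕ) → ESet r → ℕ → Set
SizeAtMost r X n =
  Σ[ ψ ∈ (Σ (Elt r) X → Fin n) ] (∀ p q → ψ p ≡ ψ q → proj₁ p ≡ proj₁ q)

-- Kin(r) = truncation of M_{r+1} to rank r.
IndepKin : (r : ℕ) → ESet r → Set
IndepKin r X = IndepM r X × SizeAtMost r X r

Circuit : (r : ℕ) → ESet r → Set₁
Circuit r C =
  (¬ IndepKin r C)
  × (∀ (Y : ESet r) → Y ⊆ C → (∃[ x ] (x ∈ C × x ∉ Y)) → IndepKin r Y)

Basis : (r : ℕ) → ESet r → Set₁
Basis r B =
  IndepKin r B × (∀ (Y : ESet r) → B ⊆ Y → IndepKin r Y → Y ⊆ B)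

Spanning : (r : ℕ) → ESet r → Set₁
Spanning r X = Σ[ B ∈ ESet r ] (B ⊆ X × Basis r B)

Hyperplane : (r : ℕ) → ESet r → Set₁
Hyperplane r X =
  (¬ Spanning r X) × (∀ x → x ∉ X → Spanning r (X ∪ ｛ x ｝))

CircuitHyperplane : (r : ℕ) → ESet r → Set₁
CircuitHyperplane r X = Circuit r X × Hyperplane r X

-- Write s⁺ for the cyclic successor of s. Besides A', the only sets of the family missing H_s are
-- A_s and A_{s⁺}, and no A_k meets H_r, so every matching of a subset X of C = H_s ∪ H_r avoids A_s
-- and A_{s⁺}. Any x outside C lies in A_s or in A_{s⁺}; matching it there still leaves one of the
-- r + 2 sets unused, so X ∪ {x} has at most r elements and is independent in Kin(r). For X = C that
-- set has r + 1 elements, so C is dependent; a basis inside C could be enlarged, so C does not span.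
-- Up to swapping e with f and permuting H_s, removing an element from C leaves C - f or
-- C - (first element of H_s), both of which have explicit matchings; so C is a circuit. Finally
-- (C - f) ∪ {x} is independent with r elements, hence a basis, so C ∪ {x} spans.

module Submission where

open import Defs
open import Data.Nat using (ℕ; _≤_; _∸_)
open import Data.Fin using (Fin)
open import Relation.Unary using (_∪_)

open import Data.Nat as ℕ using (zero; suc; s≤s)
import Data.Nat.Properties as ℕ
open import Data.Fin using (zero; suc; toℕ; fromℕ<; punchIn; punchOut; _≟_)
open import Data.Fin.Properties
  using (toℕ-injective; toℕ-fromℕ<; toℕ<n; injective⇒≤; punchIn-injective; punchInᵢ≢i;
         punchIn-punchOut; punchOut-injective)
open import Data.Fin.Permutation using (Permutation′; _⟨$⟩ʳ_; _⟨$⟩ˡ_; inverseˡ; transpose)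
open import Data.Product using (Σ; Σ-syntax; ∃-syntax; _×_; _,_; proj₁; proj₂)
open import Data.Sum using (_⊎_; inj₁; inj₂; [_,_]′; map₁)
open import Data.Unit using (tt)
open import Function using (_∘_; id)
open import Function.Definitions using (Injective)
open import Relation.Binary.Definitions using (DecidableEquality)
open import Relation.Binary.PropositionalEquality using (_≡_; _≢_; refl; sym; trans; cong; cong₂; subst)
open import Relation.Nullary using (¬_; yes; no; contradiction)
open import Relation.Nullary.Decidable using (map′; _×-dec_)
open import Relation.Unary using (Decidable; _⊆_; _∈_; _∉_; _∖_; ｛_｝)
open import Relation.Unary.Properties using (_∪?_; _∩?_; ∁?)

private variable
  m n r N a a′ b b′ c : ℕ

-- Stated so that Excluded (2 + m) k j is literally toℕ j ≡ toℕ k ⊎ CyclicSuc (1 + m) (toℕ j) (toℕ k).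
CyclicSuc : ℕ → ℕ → ℕ → Set
CyclicSuc N a b = suc a ≡ b ⊎ (b ≡ 0 × suc a ≡ N)

cyclicSuc-unique : b ℕ.< N → b′ ℕ.< N → CyclicSuc N a b → CyclicSuc N a b′ → b ≡ b′
cyclicSuc-unique _   _    (inj₁ refl)       (inj₁ refl)       = refl
cyclicSuc-unique b<N _    (inj₁ refl)       (inj₂ (_ , refl)) = contradiction b<N (ℕ.n≮n _)
cyclicSuc-unique _   b′<N (inj₂ (_ , refl)) (inj₁ refl)       = contradiction b′<N (ℕ.n≮n _)
cyclicSuc-unique _   _    (inj₂ (refl , _)) (inj₂ (refl , _)) = refl

cyclicSuc-injective : CyclicSuc N a b → CyclicSuc N a′ b → a ≡ a′
cyclicSuc-injective (inj₁ refl)       (inj₁ refl)       = refl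
cyclicSuc-injective (inj₁ refl)       (inj₂ (() , _))
cyclicSuc-injective (inj₂ (refl , _)) (inj₁ ())
cyclicSuc-injective (inj₂ (_ , refl)) (inj₂ (_ , eq))   = ℕ.suc-injective (sym eq)

cyclicSuc-≢ : CyclicSuc (suc (suc N)) a b → a ≢ b
cyclicSuc-≢ (inj₁ refl)        = ℕ.1+n≢n ∘ sym
cyclicSuc-≢ (inj₂ (refl , ())) refl

cyclicSuc²-≢ : CyclicSuc (suc (suc (suc N))) a b → CyclicSuc (suc (suc (suc N))) b c → a ≢ c
cyclicSuc²-≢ (inj₁ refl)        (inj₁ refl)        = ℕ.m≢1+n+m _
cyclicSuc²-≢ (inj₁ refl)        (inj₂ (refl , ())) refl
cyclicSuc²-≢ (inj₂ (refl , ())) (inj₁ refl)        refl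
cyclicSuc²-≢ (inj₂ (refl , _))  (inj₂ (refl , ()))

next : Fin (suc m) → Fin (suc m)
next {m} i with suc (toℕ i) ℕ.<? suc m
... | yes i+1<1+m = fromℕ< i+1<1+m
... | no  _       = zero

next-spec : (i : Fin (suc m)) → CyclicSuc (suc m) (toℕ i) (toℕ (next i))
next-spec {m} i with suc (toℕ i) ℕ.<? suc m
... | yes i+1<1+m = inj₁ (sym (toℕ-fromℕ< i+1<1+m))
... | no  i+1≮1+m = inj₂ (refl , ℕ.≤-antisym (toℕ<n i) (ℕ.≮⇒≥ i+1≮1+m))

next-injective : Injective _≡_ _≡_ (next {m})
next-injective {x = i} {y = j} eq = toℕ-injective
  (cyclicSuc-injective (next-spec i) (subst (CyclicSuc _ (toℕ j) ∘ toℕ) (sym eq) (next-spec j)))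

next-≢ : (i : Fin (suc (suc m))) → i ≢ next i
next-≢ i = cyclicSuc-≢ (next-spec i) ∘ cong toℕ

next²-≢ : (i : Fin (suc (suc (suc m)))) → i ≢ next (next i)
next²-≢ i = cyclicSuc²-≢ (next-spec i) (next-spec (next i)) ∘ cong toℕ

excluded⁺ : {k j : Fin (suc m)} → k ≡ j ⊎ k ≡ next j → Excluded (suc (suc m)) k j
excluded⁺ (inj₁ refl) = inj₁ refl
excluded⁺ {j = j} (inj₂ refl) = inj₂ (next-spec j)

excluded⁻ : {k j : Fin (suc m)} → Excluded (suc (suc m)) k j → k ≡ j ⊎ k ≡ next j
excluded⁻ (inj₁ j≡k) = inj₁ (toℕ-injective (sym j≡k))
excluded⁻ {k = k} {j} (inj₂ k-succ) =
  inj₂ (toℕ-injective (cyclicSuc-unique (toℕ<n k) (toℕ<n (next j)) k-succ (next-spec j)))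

skip₂ : {i j : Fin (suc (suc m))} → i ≢ j → Fin m → Fin (suc (suc m))
skip₂ {i = i} i≢j k = punchIn i (punchIn (punchOut i≢j) k)

module _ {i j : Fin (suc (suc m))} (i≢j : i ≢ j) where

  skip₂-injective : Injective _≡_ _≡_ (skip₂ i≢j)
  skip₂-injective = punchIn-injective (punchOut i≢j) _ _ ∘ punchIn-injective i _ _

  skip₂-≢ˡ : ∀ k → skip₂ i≢j k ≢ i
  skip₂-≢ˡ k = punchInᵢ≢i i _

  skip₂-≢ʳ : ∀ k → skip₂ i≢j k ≢ j
  skip₂-≢ʳ k eq =
    punchInᵢ≢i (punchOut i≢j) k (punchIn-injective i _ _ (trans eq (sym (punchIn-punchOut i≢j))))

blk-injective : ∀ {j j′ k k′} → blk {r} j k ≡ blk j′ k′ → j ≡ j′ × k ≡ k′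
blk-injective refl = refl , refl

_≟ᴱ_ : DecidableEquality (Elt r)
blk j k ≟ᴱ blk j′ k′ = map′ (λ (p , q) → cong₂ blk p q) blk-injective (j ≟ j′ ×-dec k ≟ k′)
blk _ _ ≟ᴱ e       = no λ ()
blk _ _ ≟ᴱ f       = no λ ()
e       ≟ᴱ blk _ _ = no λ ()
e       ≟ᴱ e       = yes refl
e       ≟ᴱ f       = no λ ()
f       ≟ᴱ blk _ _ = no λ ()
f       ≟ᴱ e       = no λ ()
f       ≟ᴱ f       = yes refl

H? : (j : Fin (r ∸ 1)) → Decidable (H r j)
H? j (blk j′ _) = j′ ≟ j
H? j e          = no λ ()
H? j f          = no λ ()

Hr? : Decidable (Hr r)
Hr? (blk _ _) = no λ ()
Hr? e         = yes tt
Hr? f         = yes tt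

setA-injective : ∀ {k k′} → setA {r} k ≡ setA k′ → k ≡ k′
setA-injective refl = refl

encode : Idx (suc r) → Fin (suc (suc r))
encode whole    = zero
encode prime    = suc zero
encode (setA k) = suc (suc k)

decode : Fin (suc (suc r)) → Idx (suc r)
decode zero          = whole
decode (suc zero)    = prime
decode (suc (suc k)) = setA k

decode-encode : (i : Idx (suc r)) → decode (encode i) ≡ i
decode-encode whole    = refl
decode-encode prime    = refl
decode-encode (setA _) = refl

encode-injective : Injective _≡_ _≡_ (encode {r})
encode-injective {x = i} {y = j} eq = trans (sym (decode-encode i)) (trans (cong decode eq) (decode-encode j))

Avoids : {X : ESet r} → IndepM r X → Idx r → Set
Avoids (φ , _) i = ∀ p → φ p ≢ i

IndepM-from : {X : ESet r} (g : Elt r → Idx r) →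
              (∀ {x y} → x ∈ X → y ∈ X → g x ≡ g y → x ≡ y) →
              (∀ {x} → x ∈ X → Mem r (g x) x) → IndepM r X
IndepM-from g g-inj g-mem =
  g ∘ proj₁ , (λ (_ , x∈X) (_ , y∈X) → g-inj x∈X y∈X) , (λ (_ , x∈X) → g-mem x∈X)

SizeAtMost-avoiding : {X : ESet (suc r)} {i : Idx (suc r)} (m : IndepM (suc r) X) →
                      Avoids m i → SizeAtMost (suc r) X (suc r)
SizeAtMost-avoiding {r} {X} {i} (φ , φ-inj , _) φ≢i = χ , χ-inj
  where
  encode-≢ : ∀ p → encode i ≢ encode (φ p)
  encode-≢ p = φ≢i p ∘ sym ∘ encode-injective
  χ : Σ (Elt (suc r)) X → Fin (suc r)
  χ p = punchOut (encode-≢ p)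
  χ-inj : ∀ p q → χ p ≡ χ q → proj₁ p ≡ proj₁ q
  χ-inj p q = φ-inj p q ∘ encode-injective ∘ punchOut-injective (encode-≢ p) (encode-≢ q)

IndepKin-insert : {X : ESet (suc r)} {i j : Idx (suc r)} {x : Elt (suc r)} (m : IndepM (suc r) X) →
                  Avoids m i → Avoids m j → i ≢ j → Mem (suc r) i x → IndepKin (suc r) (X ∪ ｛ x ｝)
IndepKin-insert {r} {X} {i} {j} {x} (φ , φ-inj , φ-mem) φ≢i φ≢j i≢j x∈Aᵢ =
  m′ , SizeAtMost-avoiding m′ φ′≢j
  where
  φ′ : Σ (Elt (suc r)) (X ∪ ｛ x ｝) → Idx (suc r)
  φ′ (y , inj₁ y∈X) = φ (y , y∈X)
  φ′ (_ , inj₂ _)   = i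
  φ′-inj : ∀ p q → φ′ p ≡ φ′ q → proj₁ p ≡ proj₁ q
  φ′-inj (y , inj₁ y∈X) (z , inj₁ z∈X) = φ-inj (y , y∈X) (z , z∈X)
  φ′-inj (y , inj₁ y∈X) (_ , inj₂ _)   eq = contradiction eq (φ≢i (y , y∈X))
  φ′-inj (_ , inj₂ _)   (z , inj₁ z∈X) eq = contradiction (sym eq) (φ≢i (z , z∈X))
  φ′-inj (_ , inj₂ refl) (_ , inj₂ refl) _ = refl
  φ′-mem : ∀ p → Mem (suc r) (φ′ p) (proj₁ p)
  φ′-mem (y , inj₁ y∈X) = φ-mem (y , y∈X)
  φ′-mem (_ , inj₂ refl) = x∈Aᵢ
  m′ : IndepM (suc r) (X ∪ ｛ x ｝)
  m′ = φ′ , φ′-inj , φ′-mem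
  φ′≢j : Avoids m′ j
  φ′≢j (y , inj₁ y∈X) = φ≢j (y , y∈X)
  φ′≢j (_ , inj₂ _)   = i≢j

record Relabelling (r : ℕ) : Set where
  field
    to from       : Elt r → Elt r
    from-to       : ∀ x → from (to x) ≡ x
    to-reflects-∈ : ∀ i x → Mem r i (to x) → Mem r i x

  to-injective : Injective _≡_ _≡_ to
  to-injective {x} {y} eq = trans (sym (from-to x)) (trans (cong from eq) (from-to y))

open Relabelling

IndepKin-comap : {X Y : ESet r} (ρ : Relabelling r) → Y ⊆ X ∘ to ρ → IndepKin r X → IndepKin r Y
IndepKin-comap {r} {X} {Y} ρ Y⊆ ((φ , φ-inj , φ-mem) , ψ , ψ-inj) =
  (φ ∘ push , pull-injective φ-inj , λ p → to-reflects-∈ ρ (φ (push p)) (proj₁ p) (φ-mem (push p))) ,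
  ψ ∘ push , pull-injective ψ-inj
  where
  push : Σ (Elt r) Y → Σ (Elt r) X
  push (y , y∈Y) = to ρ y , Y⊆ y∈Y
  pull-injective : {B : Set} {g : Σ (Elt r) X → B} → (∀ p q → g p ≡ g q → proj₁ p ≡ proj₁ q) →
                   ∀ p q → g (push p) ≡ g (push q) → proj₁ p ≡ proj₁ q
  pull-injective g-inj p q = to-injective ρ ∘ g-inj (push p) (push q)

idᴿ : Relabelling r
idᴿ = record { to = id ; from = id ; from-to = λ _ → refl ; to-reflects-∈ = λ _ _ → id }

swapEF : Elt r → Elt r
swapEF (blk j k) = blk j k
swapEF e         = f
swapEF f         = e

swapᴿ : Relabelling r
swapᴿ {r} = record { to = swapEF ; from = swapEF ; from-to = involutive ; to-reflects-∈ = reflects }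
  where
  involutive : (x : Elt r) → swapEF (swapEF x) ≡ x
  involutive (blk _ _) = refl
  involutive e         = refl
  involutive f         = refl
  reflects : ∀ i x → Mem r i (swapEF x) → Mem r i x
  reflects _     (blk _ _) x∈Aᵢ = x∈Aᵢ
  reflects whole e         _    = tt
  reflects whole f         _    = tt
  reflects prime e         _    = tt
  reflects prime f         _    = tt

relabel : (Fin (r ∸ 2) → Fin (r ∸ 2)) → Elt r → Elt r
relabel σ (blk j k) = blk j (σ k)
relabel σ e         = e
relabel σ f         = f

permuteᴿ : Permutation′ (r ∸ 2) → Relabelling r
permuteᴿ {r} π = record
  { to = relabel (π ⟨$⟩ʳ_) ; from = relabel (π ⟨$⟩ˡ_) ; from-to = inverse ; to-reflects-∈ = reflects }
  where
  inverse : (x : Elt r) → relabel (π ⟨$⟩ˡ_) (relabel (π ⟨$⟩ʳ_) x) ≡ x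
  inverse (blk j _) = cong (blk j) (inverseˡ π)
  inverse e         = refl
  inverse f         = refl
  reflects : ∀ i x → Mem r i (relabel (π ⟨$⟩ʳ_) x) → Mem r i x
  reflects (setA _) (blk _ _) x∈Aᵢ = x∈Aᵢ
  reflects whole    (blk _ _) _    = tt
  reflects prime    (blk _ _) ()
  reflects _        e         x∈Aᵢ = x∈Aᵢ
  reflects _        f         x∈Aᵢ = x∈Aᵢ

SizeAtLeast : (r : ℕ) → ESet r → ℕ → Set
SizeAtLeast r X n = Σ[ ι ∈ (Fin n → Σ (Elt r) X) ] Injective _≡_ _≡_ (proj₁ ∘ ι)

SizeAtLeast∧SizeAtMost⇒≤ : {X : ESet r} → SizeAtLeast r X m → SizeAtMost r X n → m ≤ n
SizeAtLeast∧SizeAtMost⇒≤ (ι , ι-inj) (ψ , ψ-inj) = injective⇒≤ (λ {i} {j} → ι-inj ∘ ψ-inj (ι i) (ι j))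

SizeAtLeast-extend : {X Y : ESet r} {y : Elt r} → X ⊆ Y → y ∈ Y → y ∉ X →
                     SizeAtLeast r X n → SizeAtLeast r Y (suc n)
SizeAtLeast-extend {r} {n} {X} {Y} {y} X⊆Y y∈Y y∉X (ι , ι-inj) = ι′ , ι′-inj
  where
  ι′ : Fin (suc n) → Σ (Elt r) Y
  ι′ zero    = y , y∈Y
  ι′ (suc i) = proj₁ (ι i) , X⊆Y (proj₂ (ι i))
  ι′-inj : Injective _≡_ _≡_ (proj₁ ∘ ι′)
  ι′-inj {zero}  {zero}  _  = refl
  ι′-inj {zero}  {suc j} eq = contradiction (subst X (sym eq) (proj₂ (ι j))) y∉X
  ι′-inj {suc i} {zero}  eq = contradiction (subst X eq (proj₂ (ι i))) y∉X
  ι′-inj {suc i} {suc j} eq = cong suc (ι-inj eq)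

SizeAtLeast-H : (j : Fin (r ∸ 1)) → SizeAtLeast r (H r j) (r ∸ 2)
SizeAtLeast-H j = (λ k → blk j k , refl) , proj₂ ∘ blk-injective

Basis-bySize : {B : ESet r} → Decidable B → IndepKin r B → SizeAtLeast r B r → Basis r B
Basis-bySize {r} {B} B? B-indep B-large = B-indep , maximal
  where
  maximal : ∀ Y → B ⊆ Y → IndepKin r Y → Y ⊆ B
  maximal Y B⊆Y (_ , Y-small) {y} y∈Y with B? y
  ... | yes y∈B = y∈B
  ... | no  y∉B = contradiction
    (SizeAtLeast∧SizeAtMost⇒≤ (SizeAtLeast-extend B⊆Y y∈Y y∉B B-large) Y-small) (ℕ.n≮n r)

module Kinser (n : ℕ) (s : Fin (suc (suc (suc n)))) where

  R : ℕ
  R = suc (suc (suc (suc n)))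

  C : ESet R
  C = H R s ∪ Hr R

  C? : Decidable C
  C? = H? s ∪? Hr?

  s⁺ : Fin (suc (suc (suc n)))
  s⁺ = next s

  s-excluded : Excluded R s s
  s-excluded = excluded⁺ (inj₁ refl)

  s⁺-excluded : Excluded R s⁺ s
  s⁺-excluded = excluded⁺ (inj₂ refl)

  C-disjoint : ∀ {c} → Excluded R c s → ∀ {x} → x ∈ C → ¬ Mem R (setA c) x
  C-disjoint c-excluded {blk _ _} (inj₁ refl) x∈Ac = x∈Ac c-excluded
  C-disjoint _ {e} _ ()
  C-disjoint _ {f} _ ()

  C-avoids : ∀ {X c} → X ⊆ C → (m : IndepM R X) → Excluded R c s → Avoids m (setA c)
  C-avoids X⊆C (φ , _ , φ-mem) c-excluded (x , x∈X) φx≡Ac =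
    C-disjoint c-excluded (X⊆C x∈X) (subst (λ i → Mem R i x) φx≡Ac (φ-mem (x , x∈X)))

  IndepM⇒IndepKin : ∀ {X} → X ⊆ C → IndepM R X → IndepKin R X
  IndepM⇒IndepKin X⊆C m = m , SizeAtMost-avoiding m (C-avoids X⊆C m s-excluded)

  -- H_s lies in A and in the r - 3 sets A_k with k ∉ {s, s⁺}; β enumerates these r - 2 sets.
  β : Fin (suc (suc n)) → Idx R
  β zero    = whole
  β (suc k) = setA (skip₂ (next-≢ s) k)

  β-injective : Injective _≡_ _≡_ β
  β-injective {zero}  {zero}  _  = refl
  β-injective {suc _} {suc _} eq = cong suc (skip₂-injective (next-≢ s) (setA-injective eq))

  β≢prime : ∀ k → β k ≢ prime
  β≢prime zero    ()
  β≢prime (suc _) ()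

  β≡whole : ∀ {k} → β k ≡ whole → k ≡ zero
  β≡whole {zero} _ = refl

  H-in-β : ∀ k k′ → Mem R (β k) (blk s k′)
  H-in-β zero    _ = tt
  H-in-β (suc k) _ = [ skip₂-≢ˡ (next-≢ s) k , skip₂-≢ʳ (next-≢ s) k ]′ ∘ excluded⁻

  C∖f-indep : IndepKin R (C ∖ ｛ f ｝)
  C∖f-indep = IndepM⇒IndepKin proj₁ (IndepM-from g g-inj g-mem)
    where
    g : Elt R → Idx R
    g (blk _ k) = β k
    g e         = prime
    g f         = prime
    g-inj : ∀ {x y} → x ∈ C ∖ ｛ f ｝ → y ∈ C ∖ ｛ f ｝ → g x ≡ g y → x ≡ y
    g-inj {blk _ _} {blk _ _} (inj₁ refl , _) (inj₁ refl , _) = cong (blk s) ∘ β-injective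
    g-inj {blk _ k} {e} _ _ eq = contradiction eq (β≢prime k)
    g-inj {e} {blk _ k} _ _ eq = contradiction (sym eq) (β≢prime k)
    g-inj {e} {e} _ _ _ = refl
    g-inj {f} (_ , f∉) _ _ = contradiction refl f∉
    g-inj {_} {f} _ (_ , f∉) _ = contradiction refl f∉
    g-mem : ∀ {x} → x ∈ C ∖ ｛ f ｝ → Mem R (g x) x
    g-mem {blk _ k} (inj₁ refl , _) = H-in-β k k
    g-mem {e} _ = tt
    g-mem {f} _ = tt

  C∖b₀-indep : IndepKin R (C ∖ ｛ blk s zero ｝)
  C∖b₀-indep = IndepM⇒IndepKin proj₁ (IndepM-from g g-inj g-mem)
    where
    g : Elt R → Idx R
    g (blk _ k) = β k
    g e         = whole
    g f         = prime
    g-inj : ∀ {x y} → x ∈ C ∖ ｛ blk s zero ｝ → y ∈ C ∖ ｛ blk s zero ｝ → g x ≡ g y → x ≡ y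
    g-inj {blk _ _} {blk _ _} (inj₁ refl , _) (inj₁ refl , _) = cong (blk s) ∘ β-injective
    g-inj {blk _ _} {e} (inj₁ refl , ∉) _ eq = contradiction (cong (blk s) (sym (β≡whole eq))) ∉
    g-inj {e} {blk _ _} _ (inj₁ refl , ∉) eq = contradiction (cong (blk s) (sym (β≡whole (sym eq)))) ∉
    g-inj {blk _ k} {f} _ _ eq = contradiction eq (β≢prime k)
    g-inj {f} {blk _ k} _ _ eq = contradiction (sym eq) (β≢prime k)
    g-inj {e} {e} _ _ _ = refl
    g-inj {f} {f} _ _ _ = refl
    g-inj {e} {f} _ _ ()
    g-inj {f} {e} _ _ ()
    g-mem : ∀ {x} → x ∈ C ∖ ｛ blk s zero ｝ → Mem R (g x) x
    g-mem {blk _ k} (inj₁ refl , _) = H-in-β k k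
    g-mem {e} _ = tt
    g-mem {f} _ = tt

  IndepKin-insert-C : ∀ {X x a b} → X ⊆ C → (m : IndepM R X) → Excluded R a s → Excluded R b s → a ≢ b →
                      Mem R (setA a) x → IndepKin R (X ∪ ｛ x ｝)
  IndepKin-insert-C X⊆C m a-excluded b-excluded a≢b =
    IndepKin-insert m (C-avoids X⊆C m a-excluded) (C-avoids X⊆C m b-excluded) (a≢b ∘ setA-injective)

  -- x lies in one of A_s, A_{s⁺}; matching it there leaves the other one unused.
  C-insert : ∀ {X x} → x ∉ C → X ⊆ C → IndepM R X → IndepKin R (X ∪ ｛ x ｝)
  C-insert {x = e} e∉C = contradiction (inj₂ tt) e∉C
  C-insert {x = f} f∉C = contradiction (inj₂ tt) f∉C
  C-insert {x = blk t _} x∉C X⊆C m with next t ≟ s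
  ... | no  t⁺≢s = IndepKin-insert-C X⊆C m s-excluded s⁺-excluded (next-≢ s)
                     ([ x∉C ∘ inj₁ ∘ sym , t⁺≢s ∘ sym ]′ ∘ excluded⁻)
  ... | yes t⁺≡s = IndepKin-insert-C X⊆C m s⁺-excluded s-excluded (next-≢ s ∘ sym)
                     ([ next²-≢ t ∘ sym ∘ trans (cong next t⁺≡s)
                      , x∉C ∘ inj₁ ∘ sym ∘ next-injective ]′ ∘ excluded⁻)

  C∖f-large : SizeAtLeast R (C ∖ ｛ f ｝) (suc (suc (suc n)))
  C∖f-large = SizeAtLeast-extend {y = e} H⊆C∖f (inj₂ tt , λ ()) (λ ()) (SizeAtLeast-H s)
    where
    H⊆C∖f : H R s ⊆ C ∖ ｛ f ｝
    H⊆C∖f {blk _ _} x∈H = inj₁ x∈H , λ ()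

  C-large : SizeAtLeast R C R
  C-large = SizeAtLeast-extend proj₁ (inj₂ tt) (λ (_ , f∉) → f∉ refl) C∖f-large

  x₀ : Elt R
  x₀ = blk s⁺ zero

  x₀∉C : x₀ ∉ C
  x₀∉C (inj₁ s⁺≡s) = next-≢ s (sym s⁺≡s)

  C-dependent : ¬ IndepKin R C
  C-dependent (m , _) = ℕ.n≮n R (SizeAtLeast∧SizeAtMost⇒≤ C∪x₀-large C∪x₀-small)
    where
    C∪x₀-large : SizeAtLeast R (C ∪ ｛ x₀ ｝) (suc R)
    C∪x₀-large = SizeAtLeast-extend inj₁ (inj₂ refl) x₀∉C C-large
    C∪x₀-small : SizeAtMost R (C ∪ ｛ x₀ ｝) R
    C∪x₀-small = proj₂ (C-insert x₀∉C id m)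

  C-pullback : ∀ {Y c} (ρ : Relabelling R) → (∀ {y} → y ∈ C → to ρ y ∈ C) →
               IndepKin R (C ∖ ｛ c ｝) → Y ⊆ C → from ρ c ∉ Y → IndepKin R Y
  C-pullback {Y} {c} ρ ρ-preserves-C C∖c-indep Y⊆C c′∉Y = IndepKin-comap ρ Y⊆ C∖c-indep
    where
    Y⊆ : Y ⊆ (C ∖ ｛ c ｝) ∘ to ρ
    Y⊆ {y} y∈Y = ρ-preserves-C (Y⊆C y∈Y) ,
                 λ c≡ρy → c′∉Y (subst Y (sym (trans (cong (from ρ) c≡ρy) (from-to ρ y))) y∈Y)

  C-minimal : ∀ Y → Y ⊆ C → ∃[ x ] (x ∈ C × x ∉ Y) → IndepKin R Y
  C-minimal Y Y⊆C (f , _ , f∉Y) = C-pullback idᴿ id C∖f-indep Y⊆C f∉Y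
  C-minimal Y Y⊆C (e , _ , e∉Y) = C-pullback swapᴿ swap-preserves-C C∖f-indep Y⊆C e∉Y
    where
    swap-preserves-C : ∀ {y} → y ∈ C → swapEF y ∈ C
    swap-preserves-C {blk _ _} y∈C = y∈C
    swap-preserves-C {e}       _   = inj₂ tt
    swap-preserves-C {f}       _   = inj₂ tt
  -- The relabelling's inverse transpose zero k sends blk s zero back to blk s k.
  C-minimal Y Y⊆C (blk _ k , inj₁ refl , x∉Y) =
    C-pullback (permuteᴿ (transpose k zero)) permute-preserves-C C∖b₀-indep Y⊆C x∉Y
    where
    permute-preserves-C : ∀ {y} → y ∈ C → relabel (transpose k zero ⟨$⟩ʳ_) y ∈ C
    permute-preserves-C {blk _ _} y∈C = y∈C
    permute-preserves-C {e}       y∈C = y∈C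
    permute-preserves-C {f}       y∈C = y∈C

  C-nonspanning : ¬ Spanning R C
  C-nonspanning (B , B⊆C , (m , _) , B-maximal) =
    x₀∉C (B⊆C (B-maximal (B ∪ ｛ x₀ ｝) inj₁ (C-insert x₀∉C B⊆C m) (inj₂ refl)))

  C-insert-spanning : ∀ x → x ∉ C → Spanning R (C ∪ ｛ x ｝)
  C-insert-spanning x x∉C =
    B , map₁ proj₁ , Basis-bySize ((C? ∩? ∁? (f ≟ᴱ_)) ∪? (x ≟ᴱ_)) B-indep B-large
    where
    B : ESet R
    B = (C ∖ ｛ f ｝) ∪ ｛ x ｝
    B-indep : IndepKin R B
    B-indep = C-insert x∉C proj₁ (proj₁ C∖f-indep)
    B-large : SizeAtLeast R B R
    B-large = SizeAtLeast-extend inj₁ (inj₂ refl) (x∉C ∘ proj₁) C∖f-large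

  C-circuit-hyperplane : CircuitHyperplane R C
  C-circuit-hyperplane = (C-dependent , C-minimal) , (C-nonspanning , C-insert-spanning)

proposition4p4 : (r : ℕ) → 4 ≤ r → (s : Fin (r ∸ 1)) → CircuitHyperplane r (H r s ∪ Hr r)
proposition4p4 _ (s≤s (s≤s (s≤s (s≤s {n = n} _)))) s = Kinser.C-circuit-hyperplane n s
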